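{- Let $\Gamma$ be a finite, simple, connected graph of diameter $2$. Then $\Gamma$ is highly distance-balanced if and only if it is regular. Moreover, $\Gamma$ is $2$-distance-balanced but not $1$-distance-balanced if and only if $\Gamma$ is a nonregular join $\Gamma_1 + \cdots + \Gamma_t$ of $t \ge 2$ regular graphs $\Gamma_i$.
   Context: The join $\Gamma_1 + \Gamma_2$ of graphs with disjoint vertex sets is their disjoint union together with all edges joining a vertex of $\Gamma_1$ to a vertex of $\Gamma_2$ (associative and commutative). For vertices $u,v$, $W_{uv} = \{w \mid d(u,w) < d(v,w)\}$. For a positive integer $\ell$, a connected graph of diameter at least $\ell$ is $\ell$-distance-balanced if $|W_{uv}| = |W_{vu}|$ for all $u,v$ with $d(u,v)=\ell$. A connected graph of diameter $D$ is highly distance-balanced if it is $\ell$-distance-balanced for every $1 \le \ell \le D$. -}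

module Defs where

open import Data.Nat using (ℕ; zero; suc; _≤_; _<_; _<ᵇ_; _⊔_)
open import Data.Fin using (Fin)
open import Data.Bool using (Bool; true; false; _∧_; _∨_; not; if_then_else_)
open import Data.List using (List; length; filterᵇ; foldr; map; concatMap)
open import Data.Bool.ListAction using (any)
open import Data.Fin.Properties using () renaming (_≟_ to _≟F_)
open import Data.Product using (Σ; ∃; ∃-syntax; _×_)
open import Relation.Nullary using (¬_; does)
open import Relation.Binary.PropositionalEquality using (_≡_)
open import Data.List using () renaming (allFin to allFinL)

record Graph : Set where
  field
    n     : ℕ
    adj   : Fin n → Fin n → Bool
    sym   : ∀ u v → adj u v ≡ adj v u
    loopless : ∀ v → adj v v ≡ false
open Graph public

vertices : (G : Graph) → List (Fin (n G))
vertices G = allFinL (n G)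

reach : (G : Graph) → ℕ → Fin (n G) → Fin (n G) → Bool
reach G zero    u v = does (u ≟F v)
reach G (suc k) u v = reach G k u v ∨ any (λ w → reach G k u w ∧ adj G w v) (vertices G)

Connected : Graph → Set
Connected G = ∀ u v → reach G (n G) u v ≡ true

-- distance: the least k with a walk of length ≤ k from u to v
-- (searched from 0 up to n G; for connected graphs this is the graph distance)
distFrom : (G : Graph) → ℕ → ℕ → Fin (n G) → Fin (n G) → ℕ
distFrom G k zero     u v = k
distFrom G k (suc f)  u v = if reach G k u v then k else distFrom G (suc k) f u v

dist : (G : Graph) → Fin (n G) → Fin (n G) → ℕ
dist G u v = distFrom G 0 (n G) u v

diameter : Graph → ℕ
diameter G = foldr _⊔_ 0 (concatMap (λ u → map (λ v → dist G u v) (vertices G)) (vertices G))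

W : (G : Graph) → Fin (n G) → Fin (n G) → ℕ
W G u v = length (filterᵇ (λ w → dist G u w <ᵇ dist G v w) (vertices G))

-- ℓ-distance-balanced (the graph is assumed connected of diameter ≥ ℓ)
DistBalanced : (ℓ : ℕ) → Graph → Set
DistBalanced ℓ G = ∀ u v → dist G u v ≡ ℓ → W G u v ≡ W G v u

HighlyDistBalanced : Graph → Set
HighlyDistBalanced G = ∀ ℓ → 1 ≤ ℓ → ℓ ≤ diameter G → DistBalanced ℓ G

degree : (G : Graph) → Fin (n G) → ℕ
degree G v = length (filterᵇ (adj G v) (vertices G))

Regular : Graph → Set
Regular G = ∃[ k ] (∀ v → degree G v ≡ k)

-- G is (isomorphic to) a join Γ_1 + ... + Γ_t of t regular graphs:
-- a surjective labelling part : V → Fin t of the vertices into t nonempty classes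
-- (the vertex sets of Γ_1,…,Γ_t) such that any two vertices in different classes
-- are adjacent, and each induced subgraph Γ_i on class i is regular.
degreeIn : (G : Graph) {t : ℕ} → (Fin (n G) → Fin t) → Fin (n G) → ℕ
degreeIn G part v =
  length (filterᵇ (λ w → adj G v w ∧ does (part v ≟F part w)) (vertices G))

JoinOfRegular : ℕ → Graph → Set
JoinOfRegular t G =
  Σ (Fin (n G) → Fin t) λ part →
      (∀ i → ∃[ v ] part v ≡ i)
    × (∀ u v → ¬ (part u ≡ part v) → adj G u v ≡ true)
    × (∀ i → ∃[ k ] (∀ v → part v ≡ i → degreeIn G part v ≡ k))

-- In a graph of diameter 2 a vertex w ≠ x is at distance 1 or 2 from x according as it is
-- adjacent to x or not. Hence for w ∉ {u, v} the summand 1[d(u,w) < d(v,w)] + 1[w ~ v] is the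
-- indicator of w ∈ N(u) ∪ N(v), which is symmetric in u and v, while at w = u, v the summand is
-- exchanged with the one for (v, u). Summing over all w gives |W_uv| + deg v = |W_vu| + deg u, so
-- an ℓ-balanced pair (ℓ = 1, 2) is exactly a pair of adjacent (resp. distinct non-adjacent)
-- vertices of equal degree. Regularity is therefore the same as being 1- and 2-balanced, and a
-- 2-balanced graph is the join of its degree classes, each of which is regular because all its
-- vertices have the same number of neighbours outside the class.
module Submission where

open import Defs
open import Data.Nat using (ℕ; _≤_)
open import Data.Product using (_×_; ∃-syntax)
open import Relation.Nullary using (¬_)
open import Relation.Binary.PropositionalEquality using (_≡_)
open import Function.Bundles using (_⇔_)

import Data.Bool as Bool
open import Data.Bool using (Bool; true; false; _∧_; not; if_then_else_)
open import Data.Bool.Properties using (T-≡; T-∧; T-∨; ∧-identityʳ; ¬-not)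
open import Data.Empty using (⊥-elim)
open import Data.Fin using (Fin; zero; suc; _≟_)
open import Data.Fin.Permutation using (transpose)
import Data.Fin.Permutation.Components as PC
open import Data.Fin.Properties using (any?; suc-injective; toℕ<n)
open import Data.List using (List; length; filterᵇ; foldr; tabulate)
open import Data.List.Membership.Propositional using (_∈_)
open import Data.List.Membership.Propositional.Properties using (∈-map⁺; ∈-tabulate⁺; ∈-concatMap⁺)
open import Data.List.Relation.Unary.Any using (here; there; satisfied)
open import Data.List.Relation.Unary.Any.Properties using (any⁺; any⁻; tabulate⁺)
import Data.Nat as ℕ
open import Data.Nat using (zero; suc; _+_; _<_; _<ᵇ_; _⊔_; z≤n; s≤s; _≤?_)
open import Data.Nat.Properties
  using ( ≤-trans; ≤-antisym; ≤-reflexive; ≤-<-trans; <-irrefl; ≤∧≢⇒<; ≮⇒≥; ≰⇒>; n≤0⇒n≡0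
        ; m≤m⊔n; m≤n⊔m; +-identityʳ; +-suc; +-cancelˡ-≡; +-cancelʳ-≡; +-0-commutativeMonoid )
open import Algebra.Properties.CommutativeMonoid.Sum +-0-commutativeMonoid
  using (sum-syntax; sum-cong-≗; ∑-distrib-+; sum-permute)
open import Data.Product using (_,_)
open import Data.Sum using (_⊎_; inj₁; inj₂; [_,_]′)
import Data.Vec.Functional as Vector
open import Function using (_∘_; id)
open import Function.Bundles using (mk⇔; Equivalence)
open import Relation.Binary.Definitions using (DecidableEquality)
open import Relation.Binary.PropositionalEquality as ≡
  using (_≢_; refl; trans; cong; cong₂; subst; module ≡-Reasoning)
open import Relation.Nullary using (yes; no; does)
open import Relation.Nullary.Decidable using (dec-true; dec-false; decidable-stable)

open Equivalence using (to; from)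

private
  variable
    m : ℕ

true≢false : true ≢ false
true≢false ()

distinct⇒2≤ : {i j : Fin m} → i ≢ j → 2 ≤ m
distinct⇒2≤ {suc zero}    {zero} {zero} i≢j = ⊥-elim (i≢j refl)
distinct⇒2≤ {suc (suc _)} _                 = s≤s (s≤s z≤n)

pairwise-equal⇒constant : (f : Fin m → ℕ) → (∀ u v → f u ≡ f v) → ∃[ k ] (∀ v → f v ≡ k)
pairwise-equal⇒constant {zero}  f _  = 0 , λ ()
pairwise-equal⇒constant {suc m} f eq = f zero , λ v → eq v zero

∈⇒≤foldr-⊔ : ∀ {x} {xs : List ℕ} → x ∈ xs → x ≤ foldr _⊔_ 0 xs
∈⇒≤foldr-⊔ (here refl) = m≤m⊔n _ _
∈⇒≤foldr-⊔ (there x∈xs) = ≤-trans (∈⇒≤foldr-⊔ x∈xs) (m≤n⊔m _ _)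

𝟙 : Bool → ℕ
𝟙 true  = 1
𝟙 false = 0

count : (Fin m → Bool) → ℕ
count {m} p = ∑[ i < m ] 𝟙 (p i)

length-filterᵇ-tabulate : ∀ {A : Set} (p : A → Bool) (f : Fin m → A) →
  length (filterᵇ p (tabulate f)) ≡ count (p ∘ f)
length-filterᵇ-tabulate {zero}  p f = refl
length-filterᵇ-tabulate {suc m} p f with p (f zero)
... | true  = cong suc (length-filterᵇ-tabulate p (f ∘ suc))
... | false = length-filterᵇ-tabulate p (f ∘ suc)

transpose-source : (u v : Fin m) → PC.transpose u v u ≡ v
transpose-source u v rewrite dec-true (u ≟ u) refl = refl

transpose-target : (u v : Fin m) → PC.transpose u v v ≡ u
transpose-target u v with v ≟ u
... | yes refl = refl
... | no _    rewrite dec-true (v ≟ v) refl = refl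

transpose-fixed : {u v w : Fin m} → w ≢ u → w ≢ v → PC.transpose u v w ≡ w
transpose-fixed {u = u} {v} {w} w≢u w≢v rewrite dec-false (w ≟ u) w≢u | dec-false (w ≟ v) w≢v = refl

record LevelSets {A : Set} (f : Fin m → A) : Set where
  field
    size             : ℕ
    class            : Fin m → Fin size
    class-surjective : ∀ i → ∃[ v ] class v ≡ i
    class-≡⇔         : ∀ u v → class u ≡ class v ⇔ f u ≡ f v

levelSets : {A : Set} → DecidableEquality A → (f : Fin m → A) → LevelSets f
levelSets {zero}  _≟A_ f = record
  { size = 0 ; class = λ () ; class-surjective = λ () ; class-≡⇔ = λ () }
levelSets {suc m} _≟A_ f with levelSets _≟A_ (f ∘ suc) | any? (λ j → f zero ≟A f (suc j))
... | L | yes (j , f₀≡fⱼ) = record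
  { size = size ; class = class′ ; class-surjective = surjective ; class-≡⇔ = ≡⇔ }
  where
  open LevelSets L
  class′ : Fin (suc m) → Fin size
  class′ = class j Vector.∷ class
  surjective : ∀ i → ∃[ v ] class′ v ≡ i
  surjective i = let v , cv≡i = class-surjective i in suc v , cv≡i
  ≡⇔ : ∀ u v → class′ u ≡ class′ v ⇔ f u ≡ f v
  ≡⇔ zero    zero    = mk⇔ (λ _ → refl) (λ _ → refl)
  ≡⇔ zero    (suc b) = mk⇔ (trans f₀≡fⱼ ∘ to (class-≡⇔ j b)) (from (class-≡⇔ j b) ∘ trans (≡.sym f₀≡fⱼ))
  ≡⇔ (suc a) zero    = mk⇔ (≡.sym ∘ to (≡⇔ zero (suc a)) ∘ ≡.sym) (≡.sym ∘ from (≡⇔ zero (suc a)) ∘ ≡.sym)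
  ≡⇔ (suc a) (suc b) = class-≡⇔ a b
... | L | no f₀-new = record
  { size = suc size ; class = class′ ; class-surjective = surjective ; class-≡⇔ = ≡⇔ }
  where
  open LevelSets L
  class′ : Fin (suc m) → Fin (suc size)
  class′ = zero Vector.∷ λ i → suc (class i)
  surjective : ∀ i → ∃[ v ] class′ v ≡ i
  surjective zero    = zero , refl
  surjective (suc i) = let v , cv≡i = class-surjective i in suc v , cong suc cv≡i
  ≡⇔ : ∀ u v → class′ u ≡ class′ v ⇔ f u ≡ f v
  ≡⇔ zero    zero    = mk⇔ (λ _ → refl) (λ _ → refl)
  ≡⇔ zero    (suc b) = mk⇔ (λ ()) (λ e → ⊥-elim (f₀-new (b , e)))
  ≡⇔ (suc a) zero    = mk⇔ (λ ()) (λ e → ⊥-elim (f₀-new (a , ≡.sym e)))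
  ≡⇔ (suc a) (suc b) = mk⇔ (to (class-≡⇔ a b) ∘ suc-injective) (cong suc ∘ from (class-≡⇔ a b))

module _ (G : Graph) where

  private
    V = Fin (n G)

  reach-distFrom : ∀ k f (u v : V) → distFrom G k f u v < k + f → reach G (distFrom G k f u v) u v ≡ true
  reach-distFrom k zero    u v lt = ⊥-elim (<-irrefl (≡.sym (+-identityʳ k)) lt)
  reach-distFrom k (suc f) u v lt with reach G k u v in r
  ... | true  = r
  ... | false = reach-distFrom (suc k) f u v (subst (distFrom G (suc k) f u v <_) (+-suc k f) lt)

  ¬reach-below-distFrom : ∀ k f (u v : V) j → k ≤ j → j < distFrom G k f u v → reach G j u v ≡ false
  ¬reach-below-distFrom k zero    u v j k≤j j<k = ⊥-elim (<-irrefl refl (≤-<-trans k≤j j<k))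
  ¬reach-below-distFrom k (suc f) u v j k≤j j<d with reach G k u v in r
  ... | true = ⊥-elim (<-irrefl refl (≤-<-trans k≤j j<d))
  ... | false with k ℕ.≟ j
  ...   | yes refl = r
  ...   | no k≢j   = ¬reach-below-distFrom (suc k) f u v j (≤∧≢⇒< k≤j k≢j) j<d

  reach-zero⇒≡ : (u v : V) → reach G 0 u v ≡ true → u ≡ v
  reach-zero⇒≡ u v r with u ≟ v
  ... | yes u≡v = u≡v

  reach-one⇒ : (u v : V) → reach G 1 u v ≡ true → u ≡ v ⊎ adj G u v ≡ true
  reach-one⇒ u v r with reach G 0 u v in r₀
  ... | true  = inj₁ (reach-zero⇒≡ u v r₀)
  ... | false with satisfied (any⁻ (λ w → reach G 0 u w ∧ adj G w v) (vertices G) (from T-≡ r))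
  ...   | w , Tr₀∧adj with to T-∧ Tr₀∧adj
  ...     | Tr₀ , Tadj with reach-zero⇒≡ u w (to T-≡ Tr₀)
  ...       | refl = inj₂ (to T-≡ Tadj)

  adjacent⇒reach-one : (u v : V) → adj G u v ≡ true → reach G 1 u v ≡ true
  adjacent⇒reach-one u v a =
    to T-≡ (from T-∨ (inj₂ (any⁺ _ (tabulate⁺ u (from T-∧ (from T-≡ (dec-true (u ≟ u) refl) , from T-≡ a))))))

  reach⇒dist≤ : {u v : V} (j : ℕ) → reach G j u v ≡ true → dist G u v ≤ j
  reach⇒dist≤ {u} {v} j r =
    ≮⇒≥ (λ j<d → true≢false (trans (≡.sym r) (¬reach-below-distFrom 0 (n G) u v j z≤n j<d)))

  reach-dist : {u v : V} {k : ℕ} → dist G u v ≡ k → k < n G → reach G k u v ≡ true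
  reach-dist {u} {v} refl = reach-distFrom 0 (n G) u v

  dist-refl : (u : V) → dist G u u ≡ 0
  dist-refl u = n≤0⇒n≡0 (reach⇒dist≤ 0 (dec-true (u ≟ u) refl))

  dist-pos : {u v : V} → u ≢ v → 0 < dist G u v
  dist-pos {u} {v} u≢v with dist G u v in d
  ... | suc _ = s≤s z≤n
  ... | zero  = ⊥-elim (u≢v (reach-zero⇒≡ u v (reach-dist d (≤-<-trans z≤n (toℕ<n u)))))

  dist≤1⇒adjacent : {u v : V} → u ≢ v → dist G u v ≤ 1 → adj G u v ≡ true
  dist≤1⇒adjacent {u} {v} u≢v d≤1 =
    [ ⊥-elim ∘ u≢v , id ]′ (reach-one⇒ u v (reach-dist (≤-antisym d≤1 (dist-pos u≢v)) (distinct⇒2≤ u≢v)))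

  dist-adjacent : {u v : V} → adj G u v ≡ true → dist G u v ≡ 1
  dist-adjacent {u} {v} a = ≤-antisym (reach⇒dist≤ 1 (adjacent⇒reach-one u v a)) (dist-pos u≢v)
    where
    u≢v : u ≢ v
    u≢v refl = true≢false (trans (≡.sym a) (loopless G u))

  dist≡2⇒nonadjacent : {u v : V} → dist G u v ≡ 2 → adj G u v ≡ false
  dist≡2⇒nonadjacent {u} {v} d with adj G u v in a
  ... | false = refl
  ... | true with () ← trans (≡.sym (dist-adjacent a)) d

  dist≤diameter : (u v : V) → dist G u v ≤ diameter G
  dist≤diameter u v = ∈⇒≤foldr-⊔ (∈-concatMap⁺ _ (tabulate⁺ u (∈-map⁺ _ (∈-tabulate⁺ v))))

  W-count : (u v : V) → W G u v ≡ count (λ w → dist G u w <ᵇ dist G v w)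
  W-count u v = length-filterᵇ-tabulate (λ w → dist G u w <ᵇ dist G v w) id

  degree-count : (v : V) → degree G v ≡ count (adj G v)
  degree-count v = length-filterᵇ-tabulate (adj G v) id

module _ (G : Graph) {t : ℕ} (part : Fin (n G) → Fin t)
         (joined : ∀ u v → ¬ (part u ≡ part v) → adj G u v ≡ true) where

  private
    outside : Fin t → ℕ
    outside i = count (λ w → not (does (i ≟ part w)))

  degree≡degreeIn+outside : ∀ x → degree G x ≡ degreeIn G part x + outside (part x)
  degree≡degreeIn+outside x = begin
    degree G x                                    ≡⟨ degree-count G x ⟩
    count (adj G x)                               ≡⟨ sum-cong-≗ split ⟩
    ∑[ w < n G ] (𝟙 (inside w) + 𝟙 (not (same w))) ≡⟨ ∑-distrib-+ (𝟙 ∘ inside) (𝟙 ∘ not ∘ same) ⟩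
    count inside + outside (part x)               ≡⟨ cong (_+ outside (part x)) (length-filterᵇ-tabulate inside id) ⟨
    degreeIn G part x + outside (part x)          ∎
    where
    open ≡-Reasoning
    same : Fin (n G) → Bool
    same w = does (part x ≟ part w)
    inside : Fin (n G) → Bool
    inside w = adj G x w ∧ same w
    split : ∀ w → 𝟙 (adj G x w) ≡ 𝟙 (inside w) + 𝟙 (not (same w))
    split w with part x ≟ part w
    ... | yes _      = ≡.sym (trans (+-identityʳ _) (cong 𝟙 (∧-identityʳ _)))
    ... | no px≢pw rewrite joined x w px≢pw = refl

  degree≡⇔degreeIn≡ : ∀ u v → part u ≡ part v →
    degree G u ≡ degree G v ⇔ degreeIn G part u ≡ degreeIn G part v
  degree≡⇔degreeIn≡ u v pu≡pv
    rewrite degree≡degreeIn+outside u | degree≡degreeIn+outside v | pu≡pv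
    = mk⇔ (+-cancelʳ-≡ (outside (part v)) _ _) (cong (_+ outside (part v)))

module DiameterTwo (G : Graph) (diameter≡2 : diameter G ≡ 2) where

  private
    V = Fin (n G)

  dist-nonadjacent : {u v : V} → u ≢ v → adj G u v ≡ false → dist G u v ≡ 2
  dist-nonadjacent {u} {v} u≢v a =
    ≤-antisym (subst (dist G u v ≤_) diameter≡2 (dist≤diameter G u v))
              (≰⇒> (λ d≤1 → true≢false (trans (≡.sym (dist≤1⇒adjacent G u≢v d≤1)) a)))

  dist-by-adjacency : {x w : V} → x ≢ w → dist G x w ≡ (if adj G x w then 1 else 2)
  dist-by-adjacency {x} {w} x≢w with adj G x w in a
  ... | true  = dist-adjacent G a
  ... | false = dist-nonadjacent x≢w a

  W-summand : V → V → V → ℕ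
  W-summand u v w = 𝟙 (dist G u w <ᵇ dist G v w) + 𝟙 (adj G v w)

  W-summand-transpose : ∀ u v w → W-summand u v (PC.transpose u v w) ≡ W-summand v u w
  -- Deciding u ≟ w rather than w ≟ u keeps `with` from abstracting inside PC.transpose u v w.
  W-summand-transpose u v w with u ≟ w | v ≟ w
  ... | yes refl | _
    rewrite transpose-source u v | dist-refl G v | dist-refl G u | loopless G v | loopless G u = refl
  ... | no u≢w | yes refl
    rewrite transpose-target u v | dist-refl G u | dist-refl G v
          | dist-by-adjacency u≢w | dist-by-adjacency (u≢w ∘ ≡.sym) | Graph.sym G v u = refl
  ... | no u≢w | no v≢w
    rewrite transpose-fixed (u≢w ∘ ≡.sym) (v≢w ∘ ≡.sym) | dist-by-adjacency u≢w | dist-by-adjacency v≢w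
    = swap (adj G u w) (adj G v w)
    where
    swap : ∀ a b → 𝟙 ((if a then 1 else 2) <ᵇ (if b then 1 else 2)) + 𝟙 b
                 ≡ 𝟙 ((if b then 1 else 2) <ᵇ (if a then 1 else 2)) + 𝟙 a
    swap true  true  = refl
    swap true  false = refl
    swap false true  = refl
    swap false false = refl

  W+degree : ∀ u v → W G u v + degree G v ≡ W G v u + degree G u
  W+degree u v = begin
    W G u v + degree G v
      ≡⟨ cong₂ _+_ (W-count G u v) (degree-count G v) ⟩
    count (λ w → dist G u w <ᵇ dist G v w) + count (adj G v)
      ≡⟨ ∑-distrib-+ (λ w → 𝟙 (dist G u w <ᵇ dist G v w)) (𝟙 ∘ adj G v) ⟨
    ∑[ w < n G ] W-summand u v w
      ≡⟨ sum-permute (W-summand u v) (transpose u v) ⟩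
    ∑[ w < n G ] W-summand u v (PC.transpose u v w)
      ≡⟨ sum-cong-≗ (W-summand-transpose u v) ⟩
    ∑[ w < n G ] W-summand v u w
      ≡⟨ ∑-distrib-+ (λ w → 𝟙 (dist G v w <ᵇ dist G u w)) (𝟙 ∘ adj G u) ⟩
    count (λ w → dist G v w <ᵇ dist G u w) + count (adj G u)
      ≡⟨ cong₂ _+_ (W-count G v u) (degree-count G u) ⟨
    W G v u + degree G u ∎
    where open ≡-Reasoning

  W-balanced⇔degree-equal : ∀ u v → W G u v ≡ W G v u ⇔ degree G u ≡ degree G v
  W-balanced⇔degree-equal u v = mk⇔
    (λ W≡ → ≡.sym (+-cancelˡ-≡ (W G v u) _ _ (trans (cong (_+ degree G v) (≡.sym W≡)) (W+degree u v))))
    (λ deg≡ → +-cancelʳ-≡ (degree G v) _ _ (trans (W+degree u v) (cong (W G v u +_) deg≡)))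

  regular⇒distBalanced : Regular G → ∀ ℓ → DistBalanced ℓ G
  regular⇒distBalanced (k , deg≡k) ℓ u v _ =
    from (W-balanced⇔degree-equal u v) (trans (deg≡k u) (≡.sym (deg≡k v)))

  distBalanced₂⇒nonadjacent-degree : DistBalanced 2 G → {u v : V} → u ≢ v → adj G u v ≡ false →
    degree G u ≡ degree G v
  distBalanced₂⇒nonadjacent-degree db₂ {u} {v} u≢v a =
    to (W-balanced⇔degree-equal u v) (db₂ u v (dist-nonadjacent u≢v a))

  distBalanced₁₂⇒regular : DistBalanced 1 G → DistBalanced 2 G → Regular G
  distBalanced₁₂⇒regular db₁ db₂ = pairwise-equal⇒constant (degree G) degree≡
    where
    degree≡ : ∀ u v → degree G u ≡ degree G v
    degree≡ u v with u ≟ v | adj G u v in a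
    ... | yes refl | _     = refl
    ... | no _     | true  = to (W-balanced⇔degree-equal u v) (db₁ u v (dist-adjacent G a))
    ... | no u≢v   | false = distBalanced₂⇒nonadjacent-degree db₂ u≢v a

  distBalanced₂⇒joinOfRegular : DistBalanced 2 G → ¬ Regular G → ∃[ t ] (2 ≤ t × JoinOfRegular t G)
  distBalanced₂⇒joinOfRegular db₂ ¬regular = size , 2≤size , class , class-surjective , joined , classes-regular
    where
    open LevelSets (levelSets ℕ._≟_ (degree G))
    joined : ∀ u v → ¬ (class u ≡ class v) → adj G u v ≡ true
    joined u v cu≢cv = decidable-stable (adj G u v Bool.≟ true) λ ¬adjacent →
      cu≢cv (from (class-≡⇔ u v) (distBalanced₂⇒nonadjacent-degree db₂ (cu≢cv ∘ cong class) (¬-not ¬adjacent)))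
    classes-regular : ∀ i → ∃[ k ] (∀ v → class v ≡ i → degreeIn G class v ≡ k)
    classes-regular i with class-surjective i
    ... | v₀ , refl = degreeIn G class v₀ , λ v cv≡cv₀ →
      to (degree≡⇔degreeIn≡ G class joined v v₀ cv≡cv₀) (to (class-≡⇔ v v₀) cv≡cv₀)
    2≤size : 2 ≤ size
    2≤size = decidable-stable (2 ≤? size) λ 2≰size → ¬regular (pairwise-equal⇒constant (degree G) λ u v →
      to (class-≡⇔ u v) (decidable-stable (class u ≟ class v) (2≰size ∘ distinct⇒2≤)))

  joinOfRegular⇒distBalanced₂ : ∀ {t} → JoinOfRegular t G → DistBalanced 2 G
  joinOfRegular⇒distBalanced₂ (part , _ , joined , classes-regular) u v d≡2 =
    from (W-balanced⇔degree-equal u v) (from (degree≡⇔degreeIn≡ G part joined u v pu≡pv) degreeIn≡)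
    where
    pu≡pv : part u ≡ part v
    pu≡pv = decidable-stable (part u ≟ part v) λ pu≢pv →
      true≢false (trans (≡.sym (joined u v pu≢pv)) (dist≡2⇒nonadjacent G d≡2))
    degreeIn≡ : degreeIn G part u ≡ degreeIn G part v
    degreeIn≡ = let k , degreeIn≡k = classes-regular (part v) in trans (degreeIn≡k u pu≡pv) (≡.sym (degreeIn≡k v refl))

theorem3p2 : (G : Graph) → Connected G → diameter G ≡ 2 →
    (HighlyDistBalanced G ⇔ Regular G)
    × ((DistBalanced 2 G × ¬ DistBalanced 1 G) ⇔ (¬ Regular G × ∃[ t ] (2 ≤ t × JoinOfRegular t G)))
theorem3p2 G _ diameter≡2 = mk⇔ highly⇒regular regular⇒highly , mk⇔ balanced⇒join join⇒balanced
  where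
  open DiameterTwo G diameter≡2

  highly⇒regular : HighlyDistBalanced G → Regular G
  highly⇒regular hdb = distBalanced₁₂⇒regular (hdb 1 (s≤s z≤n) (subst (1 ≤_) (≡.sym diameter≡2) (s≤s z≤n)))
                                              (hdb 2 (s≤s z≤n) (≤-reflexive (≡.sym diameter≡2)))

  regular⇒highly : Regular G → HighlyDistBalanced G
  regular⇒highly regular ℓ _ _ = regular⇒distBalanced regular ℓ

  balanced⇒join : DistBalanced 2 G × ¬ DistBalanced 1 G → ¬ Regular G × ∃[ t ] (2 ≤ t × JoinOfRegular t G)
  balanced⇒join (db₂ , ¬db₁) = ¬regular , distBalanced₂⇒joinOfRegular db₂ ¬regular
    where
    ¬regular : ¬ Regular G
    ¬regular regular = ¬db₁ (regular⇒distBalanced regular 1)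

  join⇒balanced : ¬ Regular G × ∃[ t ] (2 ≤ t × JoinOfRegular t G) → DistBalanced 2 G × ¬ DistBalanced 1 G
  join⇒balanced (¬regular , _ , _ , join) = db₂ , λ db₁ → ¬regular (distBalanced₁₂⇒regular db₁ db₂)
    where
    db₂ : DistBalanced 2 G
    db₂ = joinOfRegular⇒distBalanced₂ join
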